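{- If $\mathbb{H}$ is a heterogeneous lower quasi De Morgan algebra (resp. heterogeneous upper quasi De Morgan algebra, heterogeneous almost pseudocomplemented lattice, heterogeneous weak Stone algebra), then $\mathbb{H}_+$ is a lower quasi De Morgan algebra (resp. upper quasi De Morgan algebra, almost pseudocomplemented lattice, weak Stone algebra).
   Context: A heterogeneous semi De Morgan algebra (HSMA) is a tuple $(\mathbb{L},\mathbb{D},e,h)$ with: $\mathbb{L}=(L,\wedge,\vee,\top,\bot)$ a bounded distributive lattice; $\mathbb{D}=(D,\cap,\cup,{}^*,1,0)$ a De Morgan algebra (bounded distributive lattice with $0^*=1$, $1^*=0$, $(a\cup b)^*=a^*\cap b^*$, $(a\cap b)^*=a^*\cup b^*$, $a^{**}=a$); $e:\mathbb{D}\to\mathbb{L}$ an order embedding with $e(\alpha_1)\wedge e(\alpha_2)=e(\alpha_1\cap\alpha_2)$, $e(1)=\top$, $e(0)=\bot$; $h:\mathbb{L}\to\mathbb{D}$ a surjective lattice homomorphism; $h(e(\alpha))=\alpha$ for all $\alpha$. An HDPL is the same with $\mathbb{D}$ a Boolean algebra. A heterogeneous lower (resp. upper) quasi De Morgan algebra is an HSMA with $a\le e(h(a))$ (resp. $e(h(a))\le a$) for all $a\in L$. A heterogeneous almost pseudocomplemented lattice is an HDPL with $e(h(a)^*)\wedge a=\bot$ for all $a\in L$. A heterogeneous weak Stone algebra is an HDPL with $e(\alpha^*)\vee e(\alpha)=\top$ for all $\alpha\in D$. For such $\mathbb{H}$, $\mathbb{H}_+=(\mathbb{L},{}')$ with $a'=e(h(a)^*)$.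 A semi De Morgan algebra (SMA) is an algebra $(L,\wedge,\vee,{}',\top,\bot)$ with bounded distributive lattice reduct and $\bot'=\top$, $\top'=\bot$, $(a\vee b)'=a'\wedge b'$, $(a\wedge b)''=a''\wedge b''$, $a'=a'''$. A lower (resp. upper) quasi De Morgan algebra is an SMA with $a\le a''$ (resp. $a''\le a$); an almost pseudocomplemented lattice is an SMA with $a\wedge a'=\bot$; a weak Stone algebra is an SMA with $a'\vee a''=\top$. -}

module Defs where

open import Level using (Level; suc)
open import Relation.Binary.PropositionalEquality using (_≡_)
open import Data.Product using (_×_; ∃)
open import Function.Bundles using (_⇔_)

record BDLattice (c : Level) : Set (suc c) where
  infixr 7 _∧_
  infixr 6 _∨_
  field
    Carrier : Set c
    _∧_ _∨_ : Carrier → Carrier → Carrier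
    ⊤ ⊥ : Carrier
    ∧-assoc : ∀ a b d → (a ∧ b) ∧ d ≡ a ∧ (b ∧ d)
    ∨-assoc : ∀ a b d → (a ∨ b) ∨ d ≡ a ∨ (b ∨ d)
    ∧-comm : ∀ a b → a ∧ b ≡ b ∧ a
    ∨-comm : ∀ a b → a ∨ b ≡ b ∨ a
    ∧-absorbs-∨ : ∀ a b → a ∧ (a ∨ b) ≡ a
    ∨-absorbs-∧ : ∀ a b → a ∨ (a ∧ b) ≡ a
    ∧-distrib-∨ : ∀ a b d → a ∧ (b ∨ d) ≡ (a ∧ b) ∨ (a ∧ d)
    ∧-identity : ∀ a → a ∧ ⊤ ≡ a
    ∨-identity : ∀ a → a ∨ ⊥ ≡ a

  _≤_ : Carrier → Carrier → Set c
  a ≤ b = a ∧ b ≡ a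

record DeMorganAlgebra (c : Level) : Set (suc c) where
  field
    lattice : BDLattice c
  open BDLattice lattice public
  field
    _* : Carrier → Carrier
    ⊥* : ⊥ * ≡ ⊤
    ⊤* : ⊤ * ≡ ⊥
    ∨-* : ∀ a b → (a ∨ b) * ≡ (a *) ∧ (b *)
    ∧-* : ∀ a b → (a ∧ b) * ≡ (a *) ∨ (b *)
    ** : ∀ a → (a *) * ≡ a

record IsBoolean {c : Level} (D : DeMorganAlgebra c) : Set c where
  open DeMorganAlgebra D
  field
    ∧-compl : ∀ a → a ∧ (a *) ≡ ⊥
    ∨-compl : ∀ a → a ∨ (a *) ≡ ⊤

record HSMA {c : Level} (L : BDLattice c) (D : DeMorganAlgebra c) : Set c where
  private
    module L = BDLattice L
    module D = DeMorganAlgebra D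
  field
    e : D.Carrier → L.Carrier
    h : L.Carrier → D.Carrier
    e-order-embedding : ∀ α β → (e α L.≤ e β) ⇔ (α D.≤ β)
    e-∧ : ∀ α β → e α L.∧ e β ≡ e (α D.∧ β)
    e-⊤ : e D.⊤ ≡ L.⊤
    e-⊥ : e D.⊥ ≡ L.⊥
    h-∧ : ∀ a b → h (a L.∧ b) ≡ h a D.∧ h b
    h-∨ : ∀ a b → h (a L.∨ b) ≡ h a D.∨ h b
    h-surjective : ∀ α → ∃ λ a → h a ≡ α
    h∘e : ∀ α → h (e α) ≡ α

  -- the operation of ℍ₊ : a' = e(h(a)^*)
  _′ : L.Carrier → L.Carrier
  a ′ = e ((h a) D.*)

record IsSMA {c : Level} (L : BDLattice c) (_′ : BDLattice.Carrier L → BDLattice.Carrier L) : Set c where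
  open BDLattice L
  field
    ⊥′ : ⊥ ′ ≡ ⊤
    ⊤′ : ⊤ ′ ≡ ⊥
    ∨-′ : ∀ a b → (a ∨ b) ′ ≡ (a ′) ∧ (b ′)
    ∧-′′ : ∀ a b → ((a ∧ b) ′) ′ ≡ ((a ′) ′) ∧ ((b ′) ′)
    ′′′ : ∀ a → a ′ ≡ ((a ′) ′) ′

IsLowerQuasiDeMorgan : {c : Level} (L : BDLattice c) → (BDLattice.Carrier L → BDLattice.Carrier L) → Set c
IsLowerQuasiDeMorgan L _′ = IsSMA L _′ × (∀ a → a ≤ ((a ′) ′))
  where open BDLattice L

IsUpperQuasiDeMorgan : {c : Level} (L : BDLattice c) → (BDLattice.Carrier L → BDLattice.Carrier L) → Set c
IsUpperQuasiDeMorgan L _′ = IsSMA L _′ × (∀ a → ((a ′) ′) ≤ a)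
  where open BDLattice L

IsAlmostPseudocomplemented : {c : Level} (L : BDLattice c) → (BDLattice.Carrier L → BDLattice.Carrier L) → Set c
IsAlmostPseudocomplemented L _′ = IsSMA L _′ × (∀ a → a ∧ (a ′) ≡ ⊥)
  where open BDLattice L

IsWeakStone : {c : Level} (L : BDLattice c) → (BDLattice.Carrier L → BDLattice.Carrier L) → Set c
IsWeakStone L _′ = IsSMA L _′ × (∀ a → (a ′) ∨ ((a ′) ′) ≡ ⊤)
  where open BDLattice L

HLowerQuasi : {c : Level} {L : BDLattice c} {D : DeMorganAlgebra c} → HSMA L D → Set c
HLowerQuasi {L = L} H = ∀ a → a ≤ e (h a)
  where open BDLattice L
        open HSMA H

HUpperQuasi : {c : Level} {L : BDLattice c} {D : DeMorganAlgebra c} → HSMA L D → Set c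
HUpperQuasi {L = L} H = ∀ a → e (h a) ≤ a
  where open BDLattice L
        open HSMA H

HAlmostPseudocomplemented : {c : Level} {L : BDLattice c} {D : DeMorganAlgebra c} → HSMA L D → Set c
HAlmostPseudocomplemented {L = L} {D} H = IsBoolean D × (∀ a → e ((h a) D.*) ∧ a ≡ ⊥)
  where open BDLattice L
        module D = DeMorganAlgebra D
        open HSMA H

HWeakStone : {c : Level} {L : BDLattice c} {D : DeMorganAlgebra c} → HSMA L D → Set c
HWeakStone {L = L} {D} H = IsBoolean D × (∀ α → e (α D.*) ∨ e α ≡ ⊤)
  where open BDLattice L
        module D = DeMorganAlgebra D
        open HSMA H

module Submission where

-- The whole argument rests on two identities:
--   (1) h(a′) = h(a)*          since h ∘ e = id, and
--   (2) a′′ = e(h(a))          by (1) and the involutivity of *.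
-- With them, each semi De Morgan axiom for ′ on 𝕃 is the image under e of
-- the corresponding De Morgan law in 𝔻, transported along the homomorphism
-- h (which preserves ∧, ∨ and, via h ∘ e = id, also ⊤ and ⊥).  Identity (2)
-- then turns each heterogeneous condition (lower/upper quasi, almost
-- pseudocomplemented, weak Stone) directly into the corresponding
-- homogeneous condition on a′′.

open import Defs
open import Level using (Level)
open import Data.Product using (_×_; _,_)
open import Relation.Binary.PropositionalEquality
  using (_≡_; sym; trans; cong; cong₂; subst; module ≡-Reasoning)

module HSMAPlus {c : Level} {L : BDLattice c} {D : DeMorganAlgebra c} (H : HSMA L D) where
  private
    module L = BDLattice L
    module D = DeMorganAlgebra D
  open HSMA H
  open ≡-Reasoning

  h-′ : ∀ a → h (a ′) ≡ (h a) D.*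
  h-′ a = h∘e ((h a) D.*)

  ′′≡e∘h : ∀ a → (a ′) ′ ≡ e (h a)
  ′′≡e∘h a = begin
    e (h (a ′) D.*)     ≡⟨ cong (λ α → e (α D.*)) (h-′ a) ⟩
    e ((h a D.*) D.*)   ≡⟨ cong e (D.** (h a)) ⟩
    e (h a)             ∎

  -- h preserves the bounds, because e does and h ∘ e = id.
  h-⊥ : h L.⊥ ≡ D.⊥
  h-⊥ = trans (cong h (sym e-⊥)) (h∘e D.⊥)

  h-⊤ : h L.⊤ ≡ D.⊤
  h-⊤ = trans (cong h (sym e-⊤)) (h∘e D.⊤)

  ⊥′ : L.⊥ ′ ≡ L.⊤
  ⊥′ = begin
    e (h L.⊥ D.*)  ≡⟨ cong (λ α → e (α D.*)) h-⊥ ⟩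
    e (D.⊥ D.*)    ≡⟨ cong e D.⊥* ⟩
    e D.⊤          ≡⟨ e-⊤ ⟩
    L.⊤            ∎

  ⊤′ : L.⊤ ′ ≡ L.⊥
  ⊤′ = begin
    e (h L.⊤ D.*)  ≡⟨ cong (λ α → e (α D.*)) h-⊤ ⟩
    e (D.⊤ D.*)    ≡⟨ cong e D.⊤* ⟩
    e D.⊥          ≡⟨ e-⊥ ⟩
    L.⊥            ∎

  -- ′ turns joins into meets: h preserves ∨, * swaps it to ∩, e preserves ∩.
  ∨-′ : ∀ a b → (a L.∨ b) ′ ≡ (a ′) L.∧ (b ′)
  ∨-′ a b = begin
    e (h (a L.∨ b) D.*)           ≡⟨ cong (λ α → e (α D.*)) (h-∨ a b) ⟩
    e ((h a D.∨ h b) D.*)         ≡⟨ cong e (D.∨-* (h a) (h b)) ⟩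
    e ((h a D.*) D.∧ (h b D.*))   ≡⟨ sym (e-∧ _ _) ⟩
    (a ′) L.∧ (b ′)               ∎

  -- ′′ = e ∘ h preserves meets, since both h and e do.
  ∧-′′ : ∀ a b → ((a L.∧ b) ′) ′ ≡ ((a ′) ′) L.∧ ((b ′) ′)
  ∧-′′ a b = begin
    ((a L.∧ b) ′) ′          ≡⟨ ′′≡e∘h (a L.∧ b) ⟩
    e (h (a L.∧ b))          ≡⟨ cong e (h-∧ a b) ⟩
    e (h a D.∧ h b)          ≡⟨ sym (e-∧ (h a) (h b)) ⟩
    e (h a) L.∧ e (h b)      ≡⟨ sym (cong₂ L._∧_ (′′≡e∘h a) (′′≡e∘h b)) ⟩
    ((a ′) ′) L.∧ ((b ′) ′)  ∎

  -- a′′′ = a′, since a′′ = e(h a) and h ∘ e = id.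
  ′′′ : ∀ a → a ′ ≡ ((a ′) ′) ′
  ′′′ a = sym (begin
    e (h ((a ′) ′) D.*)   ≡⟨ cong (λ x → e (h x D.*)) (′′≡e∘h a) ⟩
    e (h (e (h a)) D.*)   ≡⟨ cong (λ α → e (α D.*)) (h∘e (h a)) ⟩
    a ′                   ∎)

  isSMA : IsSMA L _′
  isSMA = record
    { ⊥′ = ⊥′ ; ⊤′ = ⊤′ ; ∨-′ = ∨-′ ; ∧-′′ = ∧-′′ ; ′′′ = ′′′ }

  lowerQuasi : HLowerQuasi H → IsLowerQuasiDeMorgan L _′
  lowerQuasi below = isSMA , λ a →
    subst (λ x → a L.≤ x) (sym (′′≡e∘h a)) (below a)

  upperQuasi : HUpperQuasi H → IsUpperQuasiDeMorgan L _′
  upperQuasi above = isSMA , λ a →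
    subst (λ x → x L.≤ a) (sym (′′≡e∘h a)) (above a)

  almostPseudocomplemented : HAlmostPseudocomplemented H → IsAlmostPseudocomplemented L _′
  almostPseudocomplemented (_ , disjoint) = isSMA , λ a →
    trans (L.∧-comm a (a ′)) (disjoint a)

  -- Instantiating e(α*) ∨ e(α) = ⊤ at α = h a gives a′ ∨ a′′ = ⊤.
  weakStone : HWeakStone H → IsWeakStone L _′
  weakStone (_ , covering) = isSMA , λ a →
    trans (cong ((a ′) L.∨_) (′′≡e∘h a)) (covering (h a))

corollary3p12 : {c : Level} (L : BDLattice c) (D : DeMorganAlgebra c) (H : HSMA L D)
    → (HLowerQuasi H → IsLowerQuasiDeMorgan L (HSMA._′ H))
    × (HUpperQuasi H → IsUpperQuasiDeMorgan L (HSMA._′ H))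
    × (HAlmostPseudocomplemented H → IsAlmostPseudocomplemented L (HSMA._′ H))
    × (HWeakStone H → IsWeakStone L (HSMA._′ H))
corollary3p12 L D H =
  lowerQuasi , upperQuasi , almostPseudocomplemented , weakStone
  where open HSMAPlus H
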